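{- For all integers $n\ge 2$ and $0\le m\le \binom n2-1$ there exists a matrix $\rho_{n,m}$ with rows indexed by $\mathcal X(n,m)$ and columns indexed by $\mathcal X(n,m+1)$ such that all entries are nonnegative, and (a) $\sum_{\boldsymbol y\in\mathcal X(n,m+1)}\rho_{n,m}(\boldsymbol x,\boldsymbol y)=1$ for every $\boldsymbol x\in\mathcal X(n,m)$; (b) $\frac{1}{s(n,m)}\sum_{\boldsymbol x\in\mathcal X(n,m)}\rho_{n,m}(\boldsymbol x,\boldsymbol y)=\frac{1}{s(n,m+1)}$ for every $\boldsymbol y\in\mathcal X(n,m+1)$; (c) $\rho_{n,m}(\boldsymbol x,\boldsymbol y)=0$ whenever $\boldsymbol y$ does not cover $\boldsymbol x$.
   Context: $\mathcal X(n,m)$ is the set of integer sequences $\boldsymbol x=x_1x_2\cdots x_n$ with $0\le x_i\le i-1$ for all $i\in[n]$ and $x_1+\cdots+x_n=m$ (these are exactly the inversion sequences of permutations of $[n]$ with $m$ inversions, where the inversion sequence of $\boldsymbol\sigma$ has $x_i=|\{j<i:\sigma(j)>\sigma(i)\}|$). $s(n,m)=|\mathcal X(n,m)|$, the number of permutations of $[n]$ with $m$ inversions. For $\boldsymbol x\in\mathcal X(n,m)$ and $\boldsymbol y\in\mathcal X(n,m+1)$, $\boldsymbol y$ covers $\boldsymbol x$ if there is an index $j$ with $y_j=x_j+1$ and $y_i=x_i$ for all $i\ne j$. -}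

module Defs where

open import Data.Nat using (ℕ; zero; suc; _≟_; _≤_)
open import Data.Fin using (Fin; toℕ)
open import Data.List using (List; []; _∷_; [_]; map; concatMap; upTo; filter; length; foldr)
open import Data.Vec using (Vec; lookup; _∷ʳ_)
import Data.Vec as Vec
open import Data.Product using (Σ; _×_)
open import Data.Rational using (ℚ; 0ℚ; _+_; _/_)
import Data.Integer as ℤ
open import Relation.Binary.PropositionalEquality using (_≡_; _≢_)

-- A sequence x₁x₂⋯xₙ is a Vec ℕ n whose position i (0-based Fin index)
-- holds x_{i+1}; the constraint 0 ≤ x_{i+1} ≤ i is  lookup x i ≤ toℕ i.

seqs : (n : ℕ) → List (Vec ℕ n)
seqs zero    = [ Vec.[] ]
seqs (suc n) = concatMap (λ v → map (λ k → v ∷ʳ k) (upTo (suc n))) (seqs n)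

𝒳 : (n m : ℕ) → List (Vec ℕ n)
𝒳 n m = filter (λ v → Vec.sum v ≟ m) (seqs n)

s : (n m : ℕ) → ℕ
s n m = length (𝒳 n m)

Covers : {n : ℕ} → Vec ℕ n → Vec ℕ n → Set
Covers {n} y x = Σ (Fin n) λ j → (lookup y j ≡ suc (lookup x j)) × (∀ i → i ≢ j → lookup y i ≡ lookup x i)

Σℚ : {A : Set} → List A → (A → ℚ) → ℚ
Σℚ xs f = foldr (λ a acc → f a + acc) 0ℚ xs

-- 1/k as a rational (only used for k ≥ 1; 1/0 is set to 0 arbitrarily).
recip : ℕ → ℚ
recip zero    = 0ℚ
recip (suc k) = ℤ.+ 1 / suc k

module Submission where

-- The matrices are built by induction on n, for all levels at once.  A
-- sequence x = p ∷ʳ t of length n+1 either keeps its last entry t and moves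
-- its prefix p by the matrix for length n, or raises t to t+1.  The level
-- sizes satisfy  s(n+1,m) = s(n,m) + s(n,m-1) + ⋯ + s(n,m-n)  (a window of
-- s n), and the probability of raising t is the normalised flow of uniform
-- mass across the cut {last entry ≤ t}.  That these flows are nonnegative and
-- never exceed the mass at the cut rests on s n being ratio-decreasing
-- (s(n,i+1)/s(n,i) nonincreasing), a property that windows preserve by a
-- Chebyshev-type sum inequality.

module FiniteSums where

  open import Algebra.Bundles using (CommutativeMonoid)
  open import Algebra.Structures using (IsCommutativeMonoid)
  open import Data.Bool using (Bool; true; false)
  open import Data.List using (List; []; _∷_; _++_; map; concatMap; applyUpTo; filter; foldr; length)
  open import Data.List.Membership.Propositional using (_∈_)
  open import Data.List.Relation.Unary.Any using (here; there)
  open import Function.Bundles using (mk⇔)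
  open import Data.Nat using (ℕ; zero; suc; _+_; _<_; _≤_; _≟_; z≤n; s≤s)
  open import Function using (_∘_)
  open import Relation.Binary.PropositionalEquality
  open import Relation.Nullary using (does)
  open import Relation.Nullary.Decidable using (does-⇔)
  open import Level using (0ℓ)
  open import Relation.Unary using (Pred; Decidable)

  module CommutativeMonoidSums {A : Set} {_⊕_ : A → A → A} {ε : A}
                               (isCM : IsCommutativeMonoid _≡_ _⊕_ ε) where

    open IsCommutativeMonoid isCM using (assoc; identityˡ; identityʳ)
    private
      bundle : CommutativeMonoid 0ℓ 0ℓ
      bundle = record { isCommutativeMonoid = isCM }
    open import Algebra.Properties.CommutativeSemigroup
      (CommutativeMonoid.commutativeSemigroup bundle) using (interchange)

    ∑ : {B : Set} → List B → (B → A) → A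
    ∑ xs f = foldr (λ b acc → f b ⊕ acc) ε xs

    ∑< : ℕ → (ℕ → A) → A
    ∑< zero    f = ε
    ∑< (suc n) f = f 0 ⊕ ∑< n (f ∘ suc)

    when : Bool → A → A
    when true  x = x
    when false _ = ε

    when-ε : ∀ b → when b ε ≡ ε
    when-ε true  = refl
    when-ε false = refl

    when-⊕ : ∀ b x y → when b (x ⊕ y) ≡ when b x ⊕ when b y
    when-⊕ true  x y = refl
    when-⊕ false x y = sym (identityˡ ε)

    when-comm : ∀ b c x → when b (when c x) ≡ when c (when b x)
    when-comm true  c     x = refl
    when-comm false true  x = refl
    when-comm false false x = refl

    ∑-cong : ∀ {B : Set} (xs : List B) {f g : B → A} → (∀ x → f x ≡ g x) → ∑ xs f ≡ ∑ xs g
    ∑-cong []       f≡g = refl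
    ∑-cong (x ∷ xs) f≡g = cong₂ _⊕_ (f≡g x) (∑-cong xs f≡g)

    ∑-cong-∈ : ∀ {B : Set} (xs : List B) {f g : B → A} → (∀ x → x ∈ xs → f x ≡ g x) → ∑ xs f ≡ ∑ xs g
    ∑-cong-∈ []       f≡g = refl
    ∑-cong-∈ (x ∷ xs) f≡g = cong₂ _⊕_ (f≡g x (here refl)) (∑-cong-∈ xs (λ y y∈xs → f≡g y (there y∈xs)))

    ∑-empty : ∀ {B : Set} (xs : List B) (f : B → A) → length xs ≡ 0 → ∑ xs f ≡ ε
    ∑-empty [] f _ = refl

    ∑-ε : ∀ {B : Set} (xs : List B) → ∑ xs (λ _ → ε) ≡ ε
    ∑-ε []       = refl
    ∑-ε (x ∷ xs) = trans (cong (ε ⊕_) (∑-ε xs)) (identityˡ ε)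

    ∑-⊕ : ∀ {B : Set} (xs : List B) (f g : B → A) → ∑ xs (λ x → f x ⊕ g x) ≡ ∑ xs f ⊕ ∑ xs g
    ∑-⊕ []       f g = sym (identityˡ ε)
    ∑-⊕ (x ∷ xs) f g = trans (cong ((f x ⊕ g x) ⊕_) (∑-⊕ xs f g)) (interchange (f x) (g x) (∑ xs f) (∑ xs g))

    ∑-++ : ∀ {B : Set} (xs ys : List B) (f : B → A) → ∑ (xs ++ ys) f ≡ ∑ xs f ⊕ ∑ ys f
    ∑-++ []       ys f = sym (identityˡ _)
    ∑-++ (x ∷ xs) ys f = trans (cong (f x ⊕_) (∑-++ xs ys f)) (sym (assoc (f x) _ _))

    ∑-concatMap : ∀ {B C : Set} (g : B → List C) (xs : List B) (f : C → A) →
                  ∑ (concatMap g xs) f ≡ ∑ xs (λ x → ∑ (g x) f)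
    ∑-concatMap g []       f = refl
    ∑-concatMap g (x ∷ xs) f = trans (∑-++ (g x) (concatMap g xs) f) (cong (∑ (g x) f ⊕_) (∑-concatMap g xs f))

    ∑-map : ∀ {B C : Set} (h : B → C) (xs : List B) (f : C → A) → ∑ (map h xs) f ≡ ∑ xs (f ∘ h)
    ∑-map h []       f = refl
    ∑-map h (x ∷ xs) f = cong (f (h x) ⊕_) (∑-map h xs f)

    ∑-applyUpTo : ∀ {B : Set} (h : ℕ → B) n (f : B → A) → ∑ (applyUpTo h n) f ≡ ∑< n (f ∘ h)
    ∑-applyUpTo h zero    f = refl
    ∑-applyUpTo h (suc n) f = cong (f (h 0) ⊕_) (∑-applyUpTo (h ∘ suc) n f)

    ∑-filter : ∀ {B : Set} {P : Pred B 0ℓ} (P? : Decidable P) (xs : List B) (f : B → A) →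
               ∑ (filter P? xs) f ≡ ∑ xs (λ x → when (does (P? x)) (f x))
    ∑-filter P? []       f = refl
    ∑-filter P? (x ∷ xs) f with does (P? x)
    ... | true  = cong (f x ⊕_) (∑-filter P? xs f)
    ... | false = trans (∑-filter P? xs f) (sym (identityˡ _))

    ∑<-cong : ∀ n {f g : ℕ → A} → (∀ i → i < n → f i ≡ g i) → ∑< n f ≡ ∑< n g
    ∑<-cong zero    f≡g = refl
    ∑<-cong (suc n) f≡g = cong₂ _⊕_ (f≡g 0 (s≤s z≤n)) (∑<-cong n (λ i i<n → f≡g (suc i) (s≤s i<n)))

    ∑<-ε : ∀ n → ∑< n (λ _ → ε) ≡ ε
    ∑<-ε zero    = refl
    ∑<-ε (suc n) = trans (cong (ε ⊕_) (∑<-ε n)) (identityˡ ε)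

    ∑<-⊕ : ∀ n (f g : ℕ → A) → ∑< n (λ i → f i ⊕ g i) ≡ ∑< n f ⊕ ∑< n g
    ∑<-⊕ zero    f g = sym (identityˡ ε)
    ∑<-⊕ (suc n) f g = trans (cong ((f 0 ⊕ g 0) ⊕_) (∑<-⊕ n (f ∘ suc) (g ∘ suc)))
                             (interchange (f 0) (g 0) (∑< n (f ∘ suc)) (∑< n (g ∘ suc)))

    ∑<-when : ∀ n b (f : ℕ → A) → ∑< n (λ i → when b (f i)) ≡ when b (∑< n f)
    ∑<-when n true  f = refl
    ∑<-when n false f = ∑<-ε n

    ∑<-split : ∀ a b (f : ℕ → A) → ∑< (a + b) f ≡ ∑< a f ⊕ ∑< b (λ i → f (a + i))
    ∑<-split zero    b f = sym (identityˡ _)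
    ∑<-split (suc a) b f = trans (cong (f 0 ⊕_) (∑<-split a b (f ∘ suc))) (sym (assoc (f 0) _ _))

    ∑<-snoc : ∀ n (f : ℕ → A) → ∑< (suc n) f ≡ ∑< n f ⊕ f n
    ∑<-snoc zero    f = trans (identityʳ (f 0)) (sym (identityˡ (f 0)))
    ∑<-snoc (suc n) f = trans (cong (f 0 ⊕_) (∑<-snoc n (f ∘ suc))) (sym (assoc (f 0) _ _))

    ∑<-comm : ∀ n k (f : ℕ → ℕ → A) → ∑< n (λ i → ∑< k (f i)) ≡ ∑< k (λ j → ∑< n (λ i → f i j))
    ∑<-comm zero    k f = sym (∑<-ε k)
    ∑<-comm (suc n) k f = trans (cong (∑< k (f 0) ⊕_) (∑<-comm n k (f ∘ suc)))
                                (sym (∑<-⊕ k (f 0) (λ j → ∑< n (λ i → f (suc i) j))))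

    ∑-∑<-comm : ∀ {B : Set} (xs : List B) n (f : B → ℕ → A) →
                ∑ xs (λ x → ∑< n (f x)) ≡ ∑< n (λ i → ∑ xs (λ x → f x i))
    ∑-∑<-comm []       n f = sym (∑<-ε n)
    ∑-∑<-comm (x ∷ xs) n f = trans (cong (∑< n (f x) ⊕_) (∑-∑<-comm xs n f))
                                   (sym (∑<-⊕ n (f x) (λ i → ∑ xs (λ y → f y i))))

    ∑<-pick : ∀ n t (g : ℕ → A) → t < n → ∑< n (λ i → when (does (i ≟ t)) (g i)) ≡ g t
    ∑<-pick (suc n) zero    g _         = trans (cong (g 0 ⊕_) (∑<-ε n)) (identityʳ (g 0))
    ∑<-pick (suc n) (suc t) g (s≤s t<n) = trans (identityˡ _) (∑<-pick n t (g ∘ suc) t<n)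

    ∑<-pick-sym : ∀ n t (g : ℕ → A) → t < n → ∑< n (λ i → when (does (t ≟ i)) (g i)) ≡ g t
    ∑<-pick-sym n t g t<n = trans (∑<-cong n (λ i _ → cong (λ b → when b (g i)) (does-⇔ (mk⇔ sym sym) (t ≟ i) (i ≟ t))))
                                  (∑<-pick n t g t<n)

    ∑<-pick-none : ∀ n t (g : ℕ → A) → n ≤ t → ∑< n (λ i → when (does (i ≟ t)) (g i)) ≡ ε
    ∑<-pick-none zero    t       g _         = refl
    ∑<-pick-none (suc n) (suc t) g (s≤s n≤t) = trans (identityˡ _) (∑<-pick-none n t (g ∘ suc) n≤t)

    ∑∑<-when-⊕ : ∀ {B : Set} (xs : List B) n (c : B → ℕ → Bool) (f g : B → ℕ → A) →
      ∑ xs (λ x → ∑< n (λ i → when (c x i) (f x i ⊕ g x i)))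
        ≡ ∑ xs (λ x → ∑< n (λ i → when (c x i) (f x i))) ⊕ ∑ xs (λ x → ∑< n (λ i → when (c x i) (g x i)))
    ∑∑<-when-⊕ xs n c f g = trans
      (∑-cong xs (λ x → trans (∑<-cong n (λ i _ → when-⊕ (c x i) (f x i) (g x i)))
                              (∑<-⊕ n (λ i → when (c x i) (f x i)) (λ i → when (c x i) (g x i)))))
      (∑-⊕ xs _ _)

module Windows where

  open import Data.Empty using (⊥-elim)
  open import Data.Nat
  open import Data.Nat.Properties
  open import Data.Nat.Tactic.RingSolver using (solve-∀)
  open import Data.Product using (_,_)
  open import Data.Sum using (inj₁; inj₂)
  open import Function using (_∘_)
  open import Relation.Binary.PropositionalEquality
  open import Relation.Nullary using (Dec; yes; no)
  open FiniteSums

  open CommutativeMonoidSums +-0-isCommutativeMonoid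

  ∑<-mono : ∀ n {f g : ℕ → ℕ} → (∀ i → f i ≤ g i) → ∑< n f ≤ ∑< n g
  ∑<-mono zero    f≤g = z≤n
  ∑<-mono (suc n) f≤g = +-mono-≤ (f≤g 0) (∑<-mono n (f≤g ∘ suc))

  ∑<-*ˡ : ∀ n c (f : ℕ → ℕ) → c * ∑< n f ≡ ∑< n (λ i → c * f i)
  ∑<-*ˡ zero    c f = *-zeroʳ c
  ∑<-*ˡ (suc n) c f = trans (*-distribˡ-+ c (f 0) _) (cong (c * f 0 +_) (∑<-*ˡ n c (f ∘ suc)))

  ∑<-* : ∀ n k (f g : ℕ → ℕ) → ∑< n f * ∑< k g ≡ ∑< n (λ i → ∑< k (λ j → f i * g j))
  ∑<-* zero    k f g = refl
  ∑<-* (suc n) k f g = trans (*-distribʳ-+ (∑< k g) (f 0) _)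
                             (cong₂ _+_ (∑<-*ˡ k (f 0) g) (∑<-* n k (f ∘ suc) g))

  ∑<-extend : ∀ n k (f : ℕ → ℕ) → n ≤ k → ∑< n f ≤ ∑< k f
  ∑<-extend n k f n≤k with m≤n⇒∃[o]m+o≡n n≤k
  ... | o , refl = ≤-trans (m≤m+n _ _) (≤-reflexive (sym (∑<-split n o f)))

  ∑<-term : ∀ n (f : ℕ → ℕ) i → i < n → f i ≤ ∑< n f
  ∑<-term (suc n) f zero    _         = m≤m+n (f 0) _
  ∑<-term (suc n) f (suc i) (s≤s i<n) = ≤-trans (∑<-term n (f ∘ suc) i i<n) (m≤n+m _ (f 0))

  rearrangement : ∀ x x′ y y′ → x ≤ x′ → y ≤ y′ → x * y′ + x′ * y ≤ x * y + x′ * y′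
  rearrangement x x′ y y′ x≤x′ y≤y′ with m≤n⇒∃[o]m+o≡n x≤x′ | m≤n⇒∃[o]m+o≡n y≤y′
  ... | p , refl | q , refl = subst₂ _≤_ (sym (lhs x y p q)) (sym (rhs x y p q)) (m≤m+n _ (p * q))
    where
    lhs : ∀ x y p q → x * (y + q) + (x + p) * y ≡ x * y + x * y + x * q + p * y
    lhs = solve-∀
    rhs : ∀ x y p q → x * y + (x + p) * (y + q) ≡ x * y + x * y + x * q + p * y + p * q
    rhs = solve-∀

  ∑<²-symmetrised : ∀ N (f g : ℕ → ℕ → ℕ) → (∀ i j → i ≤ j → g i j + g j i ≤ f i j + f j i) →
                    ∑< N (λ i → ∑< N (g i)) ≤ ∑< N (λ i → ∑< N (f i))
  ∑<²-symmetrised N f g g≤f = *-cancelˡ-≤ 2 (subst₂ _≤_ (sym (twice g)) (sym (twice f))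
    (∑<-mono N (λ i → ∑<-mono N (λ j → symmetric i j))))
    where
    symmetric : ∀ i j → g i j + g j i ≤ f i j + f j i
    symmetric i j with ≤-total i j
    ... | inj₁ i≤j = g≤f i j i≤j
    ... | inj₂ j≤i = subst₂ _≤_ (+-comm (g j i) (g i j)) (+-comm (f j i) (f i j)) (g≤f j i j≤i)
    twice : ∀ (h : ℕ → ℕ → ℕ) → 2 * ∑< N (λ i → ∑< N (h i)) ≡ ∑< N (λ i → ∑< N (λ j → h i j + h j i))
    twice h = begin
      2 * S                                               ≡⟨ cong (S +_) (+-identityʳ S) ⟩
      S + S                                               ≡⟨ cong (S +_) (∑<-comm N N h) ⟩
      S + ∑< N (λ i → ∑< N (λ j → h j i))                 ≡⟨ sym (∑<-⊕ N _ _) ⟩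
      ∑< N (λ i → ∑< N (h i) + ∑< N (λ j → h j i))        ≡⟨ ∑<-cong N (λ i _ → sym (∑<-⊕ N (h i) (λ j → h j i))) ⟩
      ∑< N (λ i → ∑< N (λ j → h i j + h j i))             ∎
      where
      open ≡-Reasoning
      S : ℕ
      S = ∑< N (λ i → ∑< N (h i))

  cross-sum-inequality : ∀ N (u₁ u₂ v₁ v₂ : ℕ → ℕ) →
    (∀ k l → k ≤ l → u₁ k * u₂ l ≤ u₁ l * u₂ k) →
    (∀ k l → k ≤ l → v₁ k * v₂ l ≤ v₂ k * v₁ l) →
    ∑< N (λ i → u₁ i * v₂ i) * ∑< N (λ i → u₂ i * v₁ i) ≤ ∑< N (λ i → u₁ i * v₁ i) * ∑< N (λ i → u₂ i * v₂ i)
  cross-sum-inequality N u₁ u₂ v₁ v₂ u-ratio v-ratio =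
    subst₂ _≤_ (sym (∑<-* N N _ _)) (sym (∑<-* N N _ _)) (∑<²-symmetrised N _ _ pointwise)
    where
    pointwise : ∀ k l → k ≤ l →
      u₁ k * v₂ k * (u₂ l * v₁ l) + u₁ l * v₂ l * (u₂ k * v₁ k) ≤ u₁ k * v₁ k * (u₂ l * v₂ l) + u₁ l * v₁ l * (u₂ k * v₂ k)
    pointwise k l k≤l = subst₂ _≤_ (lhs (u₁ k) (u₁ l) (u₂ k) (u₂ l) (v₁ k) (v₁ l) (v₂ k) (v₂ l))
                                   (rhs (u₁ k) (u₁ l) (u₂ k) (u₂ l) (v₁ k) (v₁ l) (v₂ k) (v₂ l))
      (rearrangement (u₁ k * u₂ l) (u₁ l * u₂ k) (v₁ k * v₂ l) (v₂ k * v₁ l) (u-ratio k l k≤l) (v-ratio k l k≤l))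
      where
      lhs : ∀ a b c d e f g h → a * d * (g * f) + b * c * (e * h) ≡ a * g * (d * f) + b * h * (c * e)
      lhs = solve-∀
      rhs : ∀ a b c d e f g h → a * d * (e * h) + b * c * (g * f) ≡ a * e * (d * h) + b * f * (c * g)
      rhs = solve-∀

  -- lag a m t = a (m - t), read as 0 when t > m.
  lag : (ℕ → ℕ) → ℕ → ℕ → ℕ
  lag a m       zero    = a m
  lag a zero    (suc t) = 0
  lag a (suc m) (suc t) = lag a m t

  lag-≡ : ∀ a {m} k t → m ≡ k + t → lag a m t ≡ a k
  lag-≡ a k zero    refl = cong a (+-identityʳ k)
  lag-≡ a k (suc t) refl rewrite +-suc k t = lag-≡ a k t refl

  lag-beyond : ∀ a m t → m < t → lag a m t ≡ 0
  lag-beyond a zero    (suc t) _         = refl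
  lag-beyond a (suc m) (suc t) (s≤s m<t) = lag-beyond a m t m<t

  lag-shift : ∀ a e m k → lag a (e + m) (e + k) ≡ lag a m k
  lag-shift a zero    m k = refl
  lag-shift a (suc e) m k = lag-shift a e m k

  window : (ℕ → ℕ) → ℕ → ℕ → ℕ
  window a K m = ∑< (suc K) (lag a m)

  𝟙 : {P : Set} → Dec P → ℕ
  𝟙 (yes _) = 1
  𝟙 (no _)  = 0

  window-cut-above : ∀ a K e m → ∑< (suc K + e) (λ l → lag a m l * 𝟙 (l ≤? K)) ≡ window a K m
  window-cut-above a K e m = begin
    ∑< (suc K + e) F                              ≡⟨ ∑<-split (suc K) e F ⟩
    ∑< (suc K) F + ∑< e (λ i → F (suc K + i))     ≡⟨ cong₂ _+_ (∑<-cong (suc K) kept) (trans (∑<-cong e dropped) (∑<-ε e)) ⟩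
    window a K m + 0                              ≡⟨ +-identityʳ _ ⟩
    window a K m                                  ∎
    where
    open ≡-Reasoning
    F : ℕ → ℕ
    F l = lag a m l * 𝟙 (l ≤? K)
    kept : ∀ l → l < suc K → F l ≡ lag a m l
    kept l (s≤s l≤K) with l ≤? K
    ... | yes _   = *-identityʳ _
    ... | no l≰K = ⊥-elim (l≰K l≤K)
    dropped : ∀ i → i < e → F (suc K + i) ≡ 0
    dropped i _ with suc K + i ≤? K
    ... | yes K<K = ⊥-elim (<-irrefl refl (≤-trans (s≤s (m≤m+n K i)) K<K))
    ... | no _    = *-zeroʳ (lag a m (suc K + i))

  window-cut-below : ∀ a K e m → ∑< (suc K + e) (λ l → lag a (e + m) l * 𝟙 (e ≤? l)) ≡ window a K m
  window-cut-below a K e m = begin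
    ∑< (suc K + e) F                              ≡⟨ cong (λ N → ∑< N F) (+-comm (suc K) e) ⟩
    ∑< (e + suc K) F                              ≡⟨ ∑<-split e (suc K) F ⟩
    ∑< e F + ∑< (suc K) (λ l → F (e + l))         ≡⟨ cong₂ _+_ (trans (∑<-cong e dropped) (∑<-ε e)) (∑<-cong (suc K) kept) ⟩
    window a K m                                  ∎
    where
    open ≡-Reasoning
    F : ℕ → ℕ
    F l = lag a (e + m) l * 𝟙 (e ≤? l)
    kept : ∀ l → l < suc K → F (e + l) ≡ lag a m l
    kept l _ with e ≤? e + l
    ... | yes _    = trans (*-identityʳ _) (lag-shift a e m l)
    ... | no e≰e+l = ⊥-elim (e≰e+l (m≤m+n e l))
    dropped : ∀ i → i < e → F i ≡ 0
    dropped i i<e with e ≤? i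
    ... | yes e≤i = ⊥-elim (<-irrefl refl (<-≤-trans i<e e≤i))
    ... | no _    = *-zeroʳ (lag a (e + m) i)

  -- Ratio-decreasing sequences: a (i+1) / a i is nonincreasing, written
  -- multiplicatively so that zeros are allowed (a weak form of log-concavity).
  RatioDecreasing : (ℕ → ℕ) → Set
  RatioDecreasing a = ∀ i j → i ≤ j → a i * a (suc j) ≤ a (suc i) * a j

  lag-ratio : ∀ a → RatioDecreasing a → ∀ j k l → k ≤ l →
              lag a (suc j) k * lag a j l ≤ lag a (suc j) l * lag a j k
  lag-ratio a rd j k l k≤l with l ≤? j
  ... | no l≰j rewrite lag-beyond a j l (≰⇒> l≰j) | *-zeroʳ (lag a (suc j) k) = z≤n
  ... | yes l≤j with m≤n⇒∃[o]m+o≡n k≤l | m≤n⇒∃[o]m+o≡n l≤j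
  ... | δ , refl | x , refl =
    subst₂ _≤_ (trans (*-comm (a x) _) (sym (cong₂ _*_ (lag-≡ a _ k (e₁ k δ x)) (lag-≡ a x (k + δ) (+-comm _ x)))))
               (sym (cong₂ _*_ (lag-≡ a _ (k + δ) (e₂ k δ x)) (lag-≡ a _ k (e₃ k δ x))))
               (rd x (x + δ) (m≤m+n x δ))
    where
    e₁ : ∀ k δ x → suc (k + δ + x) ≡ suc (x + δ) + k
    e₁ = solve-∀
    e₂ : ∀ k δ x → suc (k + δ + x) ≡ suc x + (k + δ)
    e₂ = solve-∀
    e₃ : ∀ k δ x → k + δ + x ≡ x + δ + k
    e₃ = solve-∀

  -- Taking windows preserves being ratio-decreasing: for j = i + e, write all
  -- four windows as sums over the common range [0, K+1+e) cut off above K or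
  -- below e, and apply the Chebyshev-type inequality.
  window-ratio : ∀ a → RatioDecreasing a → ∀ K → RatioDecreasing (window a K)
  window-ratio a rd K i j i≤j with m≤n⇒∃[o]m+o≡n i≤j
  ... | e , refl = subst₂ _≤_
    (trans (cong₂ _*_ (window-cut-above a K e (e + suc i)) (window-cut-below a K e i))
           (trans (*-comm (window a K (e + suc i)) (window a K i)) (cong (λ z → window a K i * window a K z) (shuffle e i))))
    (cong₂ _*_ (window-cut-below a K e (suc i)) (trans (window-cut-above a K e (e + i)) (cong (window a K) (+-comm e i))))
    (cross-sum-inequality (suc K + e) (lag a (e + suc i)) (lag a (e + i)) (λ l → 𝟙 (e ≤? l)) (λ l → 𝟙 (l ≤? K))
      u-ratio v-ratio)
    where
    shuffle : ∀ e i → e + suc i ≡ suc (i + e)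
    shuffle = solve-∀
    u-ratio : ∀ k l → k ≤ l → lag a (e + suc i) k * lag a (e + i) l ≤ lag a (e + suc i) l * lag a (e + i) k
    u-ratio k l k≤l rewrite +-suc e i = lag-ratio a rd (e + i) k l k≤l
    v-ratio : ∀ k l → k ≤ l → 𝟙 (e ≤? k) * 𝟙 (l ≤? K) ≤ 𝟙 (k ≤? K) * 𝟙 (e ≤? l)
    v-ratio k l k≤l with e ≤? k | l ≤? K
    ... | no _ | _ = z≤n
    ... | yes _ | no _ = z≤n
    ... | yes e≤k | yes l≤K with k ≤? K | e ≤? l
    ... | yes _ | yes _ = ≤-refl
    ... | no k≰K | _ = ⊥-elim (k≰K (≤-trans k≤l l≤K))
    ... | yes _ | no e≰l = ⊥-elim (e≰l (≤-trans e≤k k≤l))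

  ∸-balance : ∀ x y d e → y ≤ x → x ≤ y + e → y + e ≤ x + d → (d ∸ ((x + d) ∸ (y + e))) + (x ∸ y) ≡ e
  ∸-balance x y d e y≤x x≤y+e y+e≤x+d with m≤n⇒∃[o]m+o≡n y≤x
  ... | p , refl with m≤n⇒∃[o]m+o≡n (+-cancelˡ-≤ y p e x≤y+e)
  ... | r , refl with m≤n⇒∃[o]m+o≡n (+-cancelˡ-≤ p r d (+-cancelˡ-≤ y (p + r) (p + d)
                                       (subst (y + (p + r) ≤_) (+-assoc y p d) y+e≤x+d)))
  ... | q , refl = begin
    (r + q) ∸ ((y + p + (r + q)) ∸ (y + (p + r))) + ((y + p) ∸ y)
      ≡⟨ cong (λ z → (r + q) ∸ (z ∸ (y + (p + r))) + ((y + p) ∸ y)) (regroup y p r q) ⟩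
    (r + q) ∸ ((y + (p + r) + q) ∸ (y + (p + r))) + ((y + p) ∸ y)
      ≡⟨ cong₂ (λ u v → (r + q) ∸ u + v) (m+n∸m≡n (y + (p + r)) q) (m+n∸m≡n y p) ⟩
    (r + q) ∸ q + p                                 ≡⟨ cong (_+ p) (m+n∸n≡m r q) ⟩
    r + p                                           ≡⟨ +-comm r p ⟩
    p + r                                           ∎
    where
    open ≡-Reasoning
    regroup : ∀ y p r q → y + p + (r + q) ≡ y + (p + r) + q
    regroup = solve-∀

  -- Flow across the cuts {last entry ≤ t} of a window B = window a K.
  -- Read B m as the size of level m and window a t m as the part of level m
  -- below the cut t.  Then  H t m = X t m ∸ Y t m  is (B m · B (m+1) times) the
  -- mass that a uniform-to-uniform transport from level m to level m+1 must
  -- carry across the cut, and  D t m = B (m+1) · lag a m t  is the mass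
  -- available exactly at the cut.
  module Flow (a : ℕ → ℕ) (K : ℕ) where

    B : ℕ → ℕ
    B = window a K

    X Y H D H⁻ : ℕ → ℕ → ℕ
    X t m = B (suc m) * window a t m
    Y t m = B m * window a t (suc m)
    H t m = X t m ∸ Y t m
    D t m = B (suc m) * lag a m t
    -- the flow across the previous cut (none before the first one)
    H⁻ zero    m = 0
    H⁻ (suc t) m = H t m

    X-step : ∀ t m → X (suc t) m ≡ X t m + D (suc t) m
    X-step t m = trans (cong (B (suc m) *_) (∑<-snoc (suc t) (lag a m))) (*-distribˡ-+ (B (suc m)) _ _)

    Y-step : ∀ t m → Y (suc t) m ≡ Y t m + B m * lag a m t
    Y-step t m = trans (cong (B m *_) (∑<-snoc (suc t) (lag a (suc m)))) (*-distribˡ-+ (B m) _ _)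

    -- The cut flows are nonnegative: the uniform distribution on level m+1 puts
    -- no more mass below a cut than the one on level m.
    Y≤X : RatioDecreasing a → ∀ t m → t ≤ K → Y t m ≤ X t m
    Y≤X rd t m t≤K with m≤n⇒∃[o]m+o≡n t≤K
    ... | e , refl = subst₂ _≤_
      (cong₂ _*_ (∑<-cong N (λ l _ → *-identityˡ (lag a m l))) (window-cut-above′ (suc m)))
      (cong₂ _*_ (∑<-cong N (λ l _ → *-identityˡ (lag a (suc m) l))) (window-cut-above′ m))
      (cross-sum-inequality N (λ _ → 1) (λ l → 𝟙 (l ≤? t)) (lag a (suc m)) (lag a m) below-ratio lag-ratio′)
      where
      N : ℕ
      N = suc (t + e)
      window-cut-above′ : ∀ m → ∑< N (λ l → 𝟙 (l ≤? t) * lag a m l) ≡ window a t m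
      window-cut-above′ m = trans (∑<-cong N (λ l _ → *-comm (𝟙 (l ≤? t)) (lag a m l))) (window-cut-above a t e m)
      below-ratio : ∀ k l → k ≤ l → 1 * 𝟙 (l ≤? t) ≤ 1 * 𝟙 (k ≤? t)
      below-ratio k l k≤l with l ≤? t | k ≤? t
      ... | no _    | _        = z≤n
      ... | yes _   | yes _    = ≤-refl
      ... | yes l≤t | no k≰t   = ⊥-elim (k≰t (≤-trans k≤l l≤t))
      lag-ratio′ : ∀ k l → k ≤ l → lag a (suc m) k * lag a m l ≤ lag a m k * lag a (suc m) l
      lag-ratio′ k l k≤l = subst (lag a (suc m) k * lag a m l ≤_) (*-comm (lag a (suc m) l) (lag a m k)) (lag-ratio a rd m k l k≤l)

    -- Conversely, level-(m+1) mass at cuts ≤ t+1 covers level-m mass at cuts ≤ t.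
    X≤Y-next : ∀ t m → t ≤ K → X t m ≤ Y (suc t) m
    X≤Y-next t m t≤K = begin
      B (suc m) * W                   ≤⟨ *-monoˡ-≤ W (+-monoʳ-≤ A (∑<-extend K (suc K) (lag a m) (n≤1+n K))) ⟩
      (A + B m) * W                   ≡⟨ *-distribʳ-+ W A (B m) ⟩
      A * W + B m * W                 ≤⟨ +-monoˡ-≤ (B m * W) (*-monoʳ-≤ A (∑<-extend (suc t) (suc K) (lag a m) (s≤s t≤K))) ⟩
      A * B m + B m * W               ≡⟨ cong (_+ B m * W) (*-comm A (B m)) ⟩
      B m * A + B m * W               ≡⟨ sym (*-distribˡ-+ (B m) A W) ⟩
      B m * (A + W)                   ∎
      where
      open ≤-Reasoning
      A W : ℕ
      A = a (suc m)
      W = window a t m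

    -- The flow across a cut never exceeds the mass sitting at the cut …
    H≤D : ∀ t m → t ≤ K → H t m ≤ D t m
    H≤D zero    m _     = ≤-trans (m∸n≤m (X 0 m) (Y 0 m)) (≤-reflexive (cong (B (suc m) *_) (+-identityʳ (a m))))
    H≤D (suc t) m t<K = begin
      X (suc t) m ∸ Y (suc t) m               ≡⟨ cong (_∸ Y (suc t) m) (X-step t m) ⟩
      (X t m + D (suc t) m) ∸ Y (suc t) m     ≤⟨ ∸-monoʳ-≤ (X t m + D (suc t) m) (X≤Y-next t m (<⇒≤ t<K)) ⟩
      (X t m + D (suc t) m) ∸ X t m           ≡⟨ m+n∸m≡n (X t m) (D (suc t) m) ⟩
      D (suc t) m                             ∎
      where open ≤-Reasoning

    -- … and the flows balance: what stays at cut t plus what arrives from cut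
    -- t-1 is exactly the level-(m+1) mass at cut t (scaled by B m).
    balance : RatioDecreasing a → ∀ t m → t ≤ K → (D t m ∸ H t m) + H⁻ t m ≡ B m * lag a (suc m) t
    balance rd zero m 0≤K = begin
      (D 0 m ∸ (X 0 m ∸ Y 0 m)) + 0   ≡⟨ +-identityʳ _ ⟩
      D 0 m ∸ (X 0 m ∸ Y 0 m)         ≡⟨ cong (λ z → B (suc m) * z ∸ (X 0 m ∸ Y 0 m)) (sym (+-identityʳ (a m))) ⟩
      X 0 m ∸ (X 0 m ∸ Y 0 m)         ≡⟨ m∸[m∸n]≡n (Y≤X rd 0 m 0≤K) ⟩
      Y 0 m                           ≡⟨ cong (B m *_) (+-identityʳ (a (suc m))) ⟩
      B m * a (suc m)                 ∎
      where open ≡-Reasoning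
    balance rd (suc t) m t<K rewrite X-step t m | Y-step t m =
      ∸-balance (X t m) (Y t m) (D (suc t) m) (B m * lag a m t)
        (Y≤X rd t m (<⇒≤ t<K))
        (subst (X t m ≤_) (Y-step t m) (X≤Y-next t m (<⇒≤ t<K)))
        (subst₂ _≤_ (Y-step t m) (X-step t m) (Y≤X rd (suc t) m t<K))

    -- Nothing flows across the last cut, which contains everything.
    H-top : ∀ m → H K m ≡ 0
    H-top m = trans (cong (X K m ∸_) (*-comm (B m) (B (suc m)))) (n∸n≡0 (X K m))

module Fractions where

  open import Data.Nat as ℕ using (ℕ; zero; suc; s≤s; z≤n) renaming (_≤_ to _≤ᴺ_)
  import Data.Nat.Properties as ℕ
  import Data.Nat.Coprimality as Coprime
  import Data.Integer as ℤ
  import Data.Integer.Properties as ℤP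
  open import Data.Rational
  open import Data.Rational.Properties
  open import Data.Rational.Solver using (module +-*-Solver)
  open import Data.Product using (_×_; _,_)
  open import Data.Sum using (_⊎_; inj₁; inj₂)
  open import Relation.Binary.PropositionalEquality
  open import Defs using (recip)

  open +-*-Solver

  ι : ℕ → ℚ
  ι zero    = 0ℚ
  ι (suc n) = 1ℚ + ι n

  ι-+ : ∀ a b → ι (a ℕ.+ b) ≡ ι a + ι b
  ι-+ zero    b = sym (+-identityˡ (ι b))
  ι-+ (suc a) b = trans (cong (1ℚ +_) (ι-+ a b)) (sym (+-assoc 1ℚ (ι a) (ι b)))

  ι-* : ∀ a b → ι (a ℕ.* b) ≡ ι a * ι b
  ι-* zero    b = sym (*-zeroˡ (ι b))
  ι-* (suc a) b = begin
    ι (b ℕ.+ a ℕ.* b)        ≡⟨ trans (ι-+ b (a ℕ.* b)) (cong (ι b +_) (ι-* a b)) ⟩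
    ι b + ι a * ι b          ≡⟨ solve 2 (λ x y → y :+ x :* y := (con 1ℚ :+ x) :* y) refl (ι a) (ι b) ⟩
    (1ℚ + ι a) * ι b         ∎
    where open ≡-Reasoning

  ι-normal : ∀ n → ι n ≡ mkℚ (ℤ.+ n) 0 (Coprime.sym (Coprime.1-coprimeTo n))
  ι-normal zero    = refl
  ι-normal (suc n) rewrite ι-normal n =
    trans (/-cong {p₂ = ℤ.+ suc n} {q₂ = 1} (cong (ℤ._+_ (ℤ.+ 1)) (ℤP.*-identityʳ (ℤ.+ n))) refl)
          (normalize-coprime (Coprime.sym (Coprime.1-coprimeTo (suc n))))

  ι-recip : ∀ k → ι (suc k) * recip (suc k) ≡ 1ℚ
  ι-recip k rewrite ι-normal (suc k) | normalize-coprime (Coprime.1-coprimeTo (suc k)) =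
    *-inverseʳ (mkℚ (ℤ.+ suc k) 0 (Coprime.sym (Coprime.1-coprimeTo (suc k))))

  recip-* : ∀ a b → recip (a ℕ.* b) ≡ recip a * recip b
  recip-* zero    b = sym (*-zeroˡ (recip b))
  recip-* (suc a) zero rewrite ℕ.*-zeroʳ a = sym (*-zeroʳ (recip (suc a)))
  recip-* (suc a) (suc b) = begin
    r                                        ≡⟨ solve 1 (λ r → r := r :* con 1ℚ :* con 1ℚ) refl r ⟩
    r * 1ℚ * 1ℚ                              ≡⟨ cong₂ (λ u v → r * u * v) (sym (ι-recip a)) (sym (ι-recip b)) ⟩
    r * (ι (suc a) * ra) * (ι (suc b) * rb)  ≡⟨ solve 5 (λ r A ra B rb → r :* (A :* ra) :* (B :* rb) := (A :* B :* r) :* (ra :* rb))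
                                                  refl r (ι (suc a)) ra (ι (suc b)) rb ⟩
    (ι (suc a) * ι (suc b) * r) * (ra * rb)  ≡⟨ cong (λ z → z * r * (ra * rb)) (sym (ι-* (suc a) (suc b))) ⟩
    (ι (suc a ℕ.* suc b) * r) * (ra * rb)    ≡⟨ cong (_* (ra * rb)) (ι-recip (b ℕ.+ a ℕ.* suc b)) ⟩
    1ℚ * (ra * rb)                           ≡⟨ *-identityˡ (ra * rb) ⟩
    ra * rb                                  ∎
    where
    open ≡-Reasoning
    r ra rb : ℚ
    r  = recip (suc a ℕ.* suc b)
    ra = recip (suc a)
    rb = recip (suc b)

  -- frac x d is the fraction x/d (and 0 when d = 0).
  frac : ℕ → ℕ → ℚ
  frac x d = ι x * recip d

  frac-0 : ∀ d → frac 0 d ≡ 0ℚ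
  frac-0 d = *-zeroˡ (recip d)

  frac-+ : ∀ x y d → frac x d + frac y d ≡ frac (x ℕ.+ y) d
  frac-+ x y d = trans (sym (*-distribʳ-+ (recip d) (ι x) (ι y))) (cong (_* recip d) (sym (ι-+ x y)))

  frac-self : ∀ d → 0 ℕ.< d → frac d d ≡ 1ℚ
  frac-self (suc d) _ = ι-recip d

  frac-cancel : ∀ x d c → 0 ℕ.< c → frac (x ℕ.* c) (d ℕ.* c) ≡ frac x d
  frac-cancel x d (suc c) _ = begin
    ι (x ℕ.* suc c) * recip (d ℕ.* suc c)           ≡⟨ cong₂ _*_ (ι-* x (suc c)) (recip-* d (suc c)) ⟩
    ι x * ι (suc c) * (recip d * recip (suc c))     ≡⟨ solve 4 (λ X C rd rc → X :* C :* (rd :* rc) := X :* rd :* (C :* rc))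
                                                         refl (ι x) (ι (suc c)) (recip d) (recip (suc c)) ⟩
    ι x * recip d * (ι (suc c) * recip (suc c))     ≡⟨ cong (ι x * recip d *_) (ι-recip c) ⟩
    ι x * recip d * 1ℚ                              ≡⟨ *-identityʳ _ ⟩
    ι x * recip d                                   ∎
    where open ≡-Reasoning

  frac-rescale : ∀ x b c c′ → 0 ℕ.< c → frac x (b ℕ.* c) * frac c c′ ≡ frac x (b ℕ.* c′)
  frac-rescale x b (suc c) c′ _ = begin
    ι x * recip (b ℕ.* suc c) * (ι (suc c) * recip c′)       ≡⟨ cong (λ z → ι x * z * (ι (suc c) * recip c′)) (recip-* b (suc c)) ⟩
    ι x * (recip b * recip (suc c)) * (ι (suc c) * recip c′) ≡⟨ solve 5 (λ X rb rc C rc′ → X :* (rb :* rc) :* (C :* rc′) := X :* (rb :* rc′) :* (C :* rc))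
                                                                  refl (ι x) (recip b) (recip (suc c)) (ι (suc c)) (recip c′) ⟩
    ι x * (recip b * recip c′) * (ι (suc c) * recip (suc c)) ≡⟨ cong (ι x * (recip b * recip c′) *_) (ι-recip c) ⟩
    ι x * (recip b * recip c′) * 1ℚ                          ≡⟨ *-identityʳ _ ⟩
    ι x * (recip b * recip c′)                               ≡⟨ cong (ι x *_) (sym (recip-* b c′)) ⟩
    ι x * recip (b ℕ.* c′)                                   ∎
    where open ≡-Reasoning

  recip-frac : ∀ a b → 0 ℕ.< a → recip a * frac a b ≡ recip b
  recip-frac (suc a) b _ = begin
    recip (suc a) * (ι (suc a) * recip b)   ≡⟨ sym (*-assoc (recip (suc a)) _ _) ⟩
    recip (suc a) * ι (suc a) * recip b     ≡⟨ cong (_* recip b) (trans (*-comm (recip (suc a)) _) (ι-recip a)) ⟩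
    1ℚ * recip b                            ≡⟨ *-identityˡ _ ⟩
    recip b                                 ∎
    where open ≡-Reasoning

  0≤+ : ∀ p q → 0ℚ ≤ p → 0ℚ ≤ q → 0ℚ ≤ p + q
  0≤+ p q 0≤p 0≤q = subst (_≤ p + q) (+-identityˡ 0ℚ) (+-mono-≤ 0≤p 0≤q)

  0≤* : ∀ p q → 0ℚ ≤ p → 0ℚ ≤ q → 0ℚ ≤ p * q
  0≤* p q 0≤p 0≤q = subst (_≤ p * q) (*-zeroˡ q) (*-monoʳ-≤-nonNeg q {{nonNegative 0≤q}} 0≤p)

  0≤ι : ∀ n → 0ℚ ≤ ι n
  0≤ι zero    = ≤-refl
  0≤ι (suc n) = 0≤+ 1ℚ (ι n) (nonNegative⁻¹ 1ℚ {{normalize-nonNeg 1 1}}) (0≤ι n)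

  0≤recip : ∀ d → 0ℚ ≤ recip d
  0≤recip zero    = ≤-refl
  0≤recip (suc d) = nonNegative⁻¹ (recip (suc d)) {{normalize-nonNeg 1 (suc d)}}

  0≤frac : ∀ x d → 0ℚ ≤ frac x d
  0≤frac x d = 0≤* (ι x) (recip d) (0≤ι x) (0≤recip d)

  frac-complement : ∀ D H → H ≤ᴺ D → 0 ℕ.< D → frac (D ℕ.∸ H) D + frac H D ≡ 1ℚ
  frac-complement D H H≤D 0<D =
    trans (frac-+ (D ℕ.∸ H) H D) (trans (cong (λ z → frac z D) (ℕ.m∸n+n≡m H≤D)) (frac-self D 0<D))

  frac-recombine : ∀ b b′ a a′ x y → 0 ℕ.< a′ → x ℕ.+ y ≡ b ℕ.* a′ → (a ≡ 0 → x ≡ 0) →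
                   frac x (b′ ℕ.* a) * frac a a′ + frac y (b′ ℕ.* a′) ≡ frac b b′
  frac-recombine b b′ zero a′ x y 0<a′ x+y≡ba′ x≡0 rewrite x≡0 refl = begin
    frac 0 (b′ ℕ.* 0) * frac 0 a′ + frac y (b′ ℕ.* a′) ≡⟨ cong (_+ frac y (b′ ℕ.* a′)) (trans (cong (_* frac 0 a′) (frac-0 (b′ ℕ.* 0))) (*-zeroˡ (frac 0 a′))) ⟩
    0ℚ + frac y (b′ ℕ.* a′)                            ≡⟨ +-identityˡ _ ⟩
    frac y (b′ ℕ.* a′)                                 ≡⟨ cong (λ z → frac z (b′ ℕ.* a′)) x+y≡ba′ ⟩
    frac (b ℕ.* a′) (b′ ℕ.* a′)                        ≡⟨ frac-cancel b b′ a′ 0<a′ ⟩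
    frac b b′                                          ∎
    where open ≡-Reasoning
  frac-recombine b b′ (suc a) a′ x y 0<a′ x+y≡ba′ _ = begin
    frac x (b′ ℕ.* suc a) * frac (suc a) a′ + frac y (b′ ℕ.* a′) ≡⟨ cong (_+ frac y (b′ ℕ.* a′)) (frac-rescale x b′ (suc a) a′ (s≤s z≤n)) ⟩
    frac x (b′ ℕ.* a′) + frac y (b′ ℕ.* a′)                      ≡⟨ frac-+ x y (b′ ℕ.* a′) ⟩
    frac (x ℕ.+ y) (b′ ℕ.* a′)                                   ≡⟨ cong (λ z → frac z (b′ ℕ.* a′)) x+y≡ba′ ⟩
    frac (b ℕ.* a′) (b′ ℕ.* a′)                                  ≡⟨ frac-cancel b b′ a′ 0<a′ ⟩
    frac b b′                                                    ∎
    where open ≡-Reasoning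

  -- A row of the lifted chain sums to  (D-H)/D · S + H/D = 1, both when the
  -- prefix row S is a probability row and when it is empty and H = D.
  stay-or-raise : ∀ D H S → 0 ℕ.< D → H ≤ᴺ D → (S ≡ 1ℚ ⊎ (S ≡ 0ℚ × D ℕ.∸ H ≡ 0)) →
                  frac (D ℕ.∸ H) D * S + frac H D ≡ 1ℚ
  stay-or-raise D H _ 0<D H≤D (inj₁ refl) =
    trans (cong (_+ frac H D) (*-identityʳ (frac (D ℕ.∸ H) D))) (frac-complement D H H≤D 0<D)
  stay-or-raise D H _ 0<D H≤D (inj₂ (refl , D∸H≡0)) = begin
    frac (D ℕ.∸ H) D * 0ℚ + frac H D ≡⟨ trans (cong (_+ frac H D) (*-zeroʳ (frac (D ℕ.∸ H) D))) (+-identityˡ (frac H D)) ⟩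
    frac H D                         ≡⟨ cong (λ z → frac z D) (ℕ.≤-antisym H≤D (ℕ.m∸n≡0⇒m≤n D∸H≡0)) ⟩
    frac D D                         ≡⟨ frac-self D 0<D ⟩
    1ℚ                               ∎
    where open ≡-Reasoning

module InversionSequences where

  open import Algebra.Structures using (IsCommutativeMonoid)
  open import Data.Empty using (⊥-elim)
  open import Data.List using (List; []; _∷_; map; upTo; length)
  open import Data.List.Membership.Propositional using (_∈_; find)
  open import Data.List.Membership.Propositional.Properties using (∈-filter⁻; ∈-filter⁺; ∈-concatMap⁻; ∈-map⁻; ∈-upTo⁻; ∈-length)
  open import Data.Nat
  open import Data.Nat.Properties
  open import Data.Nat.Combinatorics using (_C_; nC1≡n; nCk+nC[k+1]≡[n+1]C[k+1])
  open import Data.Product using (Σ; _×_; _,_)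
  open import Data.Vec using (Vec; _∷ʳ_; init; last) renaming ([] to []ᵥ; _∷_ to _∷ᵥ_)
  import Data.Vec as Vec
  import Data.Vec.Properties as Vec
  open import Function using (_∘_)
  open import Function.Bundles using (mk⇔)
  open import Relation.Binary.PropositionalEquality
  open import Relation.Nullary using (Dec; yes; no; does)
  open import Relation.Nullary.Decidable using (dec-true; dec-false; does-⇔)
  open import Defs
  open FiniteSums
  open Windows

  ∈-𝒳⁻ : ∀ {n m x} → x ∈ 𝒳 n m → x ∈ seqs n × Vec.sum x ≡ m
  ∈-𝒳⁻ {n} {m} = ∈-filter⁻ (λ v → Vec.sum v ≟ m)

  ∈-𝒳⁺ : ∀ {n x} → x ∈ seqs n → x ∈ 𝒳 n (Vec.sum x)
  ∈-𝒳⁺ {n} {x} x∈ = ∈-filter⁺ (λ v → Vec.sum v ≟ Vec.sum x) x∈ refl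

  ∈-seqs-suc⁻ : ∀ {n x} → x ∈ seqs (suc n) →
                Σ (Vec ℕ n) λ p → Σ ℕ λ t → p ∈ seqs n × t < suc n × x ≡ p ∷ʳ t
  ∈-seqs-suc⁻ {n} x∈ with find (∈-concatMap⁻ (λ v → map (v ∷ʳ_) (upTo (suc n))) {xs = seqs n} x∈)
  ... | p , p∈ , x∈map with ∈-map⁻ (p ∷ʳ_) x∈map
  ... | t , t∈ , refl = p , t , p∈ , ∈-upTo⁻ t∈ , refl

  sum-∷ʳ : ∀ {n} (p : Vec ℕ n) t → Vec.sum (p ∷ʳ t) ≡ Vec.sum p + t
  sum-∷ʳ []ᵥ       t = +-identityʳ t
  sum-∷ʳ (x ∷ᵥ p) t = trans (cong (x +_) (sum-∷ʳ p t)) (sym (+-assoc x (Vec.sum p) t))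

  ∈-𝒳-suc⁻ : ∀ {n m x} → x ∈ 𝒳 (suc n) m →
             init x ∈ seqs n × last x < suc n × Vec.sum (init x) + last x ≡ m
  ∈-𝒳-suc⁻ x∈ with ∈-𝒳⁻ x∈
  ... | x∈seqs , refl with ∈-seqs-suc⁻ x∈seqs
  ... | p , t , p∈ , t≤n , refl rewrite Vec.init-∷ʳ t p | Vec.last-∷ʳ t p = p∈ , t≤n , sym (sum-∷ʳ p t)

  _≟ᵥ_ : ∀ {n} (q p : Vec ℕ n) → Dec (q ≡ p)
  _≟ᵥ_ = Vec.≡-dec _≟_

  ≟ᵥ-sym : ∀ {n} (q p : Vec ℕ n) → does (q ≟ᵥ p) ≡ does (p ≟ᵥ q)
  ≟ᵥ-sym q p = does-⇔ (mk⇔ sym sym) (q ≟ᵥ p) (p ≟ᵥ q)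

  does-+ʳ : ∀ a b t → does (a + t ≟ b + t) ≡ does (a ≟ b)
  does-+ʳ a b t = does-⇔ (mk⇔ (+-cancelʳ-≡ t a b) (cong (_+ t))) (a + t ≟ b + t) (a ≟ b)

  module SequenceSums {A : Set} {_⊕_ : A → A → A} {ε : A}
                      (isCM : IsCommutativeMonoid _≡_ _⊕_ ε) where

    open CommutativeMonoidSums isCM
    open IsCommutativeMonoid isCM using (identityʳ)

    ∑-seqs-suc : ∀ n (f : Vec ℕ (suc n) → A) →
                 ∑ (seqs (suc n)) f ≡ ∑ (seqs n) (λ p → ∑< (suc n) (λ t → f (p ∷ʳ t)))
    ∑-seqs-suc n f = trans (∑-concatMap _ (seqs n) f) (∑-cong (seqs n) (λ p →
      trans (∑-map (p ∷ʳ_) (upTo (suc n)) f) (∑-applyUpTo (λ i → i) (suc n) (f ∘ (p ∷ʳ_)))))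

    ∑-𝒳-suc : ∀ n m (F : Vec ℕ n → ℕ → A) →
              ∑ (𝒳 (suc n) m) (λ x → F (init x) (last x))
                ≡ ∑ (seqs n) (λ p → ∑< (suc n) (λ t → when (does (Vec.sum p + t ≟ m)) (F p t)))
    ∑-𝒳-suc n m F = trans (∑-filter (λ v → Vec.sum v ≟ m) (seqs (suc n)) _)
      (trans (∑-seqs-suc n _) (∑-cong (seqs n) (λ p → ∑<-cong (suc n) (λ t _ →
        cong₂ (λ z w → when (does (z ≟ m)) w) (sum-∷ʳ p t) (cong₂ F (Vec.init-∷ʳ t p) (Vec.last-∷ʳ t p))))))

    ∑-seqs-level : ∀ n k t (f : Vec ℕ n → A) →
                   ∑ (seqs n) (λ p → when (does (Vec.sum p + t ≟ k + t)) (f p)) ≡ ∑ (𝒳 n k) f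
    ∑-seqs-level n k t f = trans (∑-cong (seqs n) (λ p → cong (λ b → when b (f p)) (does-+ʳ (Vec.sum p) k t)))
                                 (sym (∑-filter (λ v → Vec.sum v ≟ k) (seqs n) f))

    when-∷ʳ : ∀ {n} (q p : Vec ℕ n) u t x →
              when (does ((q ∷ʳ u) ≟ᵥ (p ∷ʳ t))) x ≡ when (does (q ≟ᵥ p)) (when (does (u ≟ t)) x)
    when-∷ʳ q p u t x with q ≟ᵥ p | (q ∷ʳ u) ≟ᵥ (p ∷ʳ t)
    ... | yes refl | yes eq rewrite dec-true (u ≟ t) (Vec.∷ʳ-injectiveʳ q q eq) = refl
    ... | yes refl | no ne with u ≟ t
    ...   | yes refl = ⊥-elim (ne refl)
    ...   | no u≢t   rewrite dec-false (u ≟ t) u≢t = refl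
    when-∷ʳ q p u t x | no ne | yes eq = ⊥-elim (ne (Vec.∷ʳ-injectiveˡ q p eq))
    when-∷ʳ q p u t x | no _  | no _   = refl

    ∑-seqs-pick : ∀ n (p : Vec ℕ n) → p ∈ seqs n → (h : Vec ℕ n → A) →
                  ∑ (seqs n) (λ q → when (does (q ≟ᵥ p)) (h q)) ≡ h p
    ∑-seqs-pick zero    []ᵥ _  h = identityʳ (h []ᵥ)
    ∑-seqs-pick (suc n) _   p∈ h with ∈-seqs-suc⁻ p∈
    ... | p , t , p∈′ , t≤n , refl = begin
      ∑ (seqs (suc n)) (λ q → when (does (q ≟ᵥ (p ∷ʳ t))) (h q))
        ≡⟨ ∑-seqs-suc n _ ⟩
      ∑ (seqs n) (λ q → ∑< (suc n) (λ u → when (does ((q ∷ʳ u) ≟ᵥ (p ∷ʳ t))) (h (q ∷ʳ u))))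
        ≡⟨ ∑-cong (seqs n) (λ q → ∑<-cong (suc n) (λ u _ → when-∷ʳ q p u t (h (q ∷ʳ u)))) ⟩
      ∑ (seqs n) (λ q → ∑< (suc n) (λ u → when (does (q ≟ᵥ p)) (when (does (u ≟ t)) (h (q ∷ʳ u)))))
        ≡⟨ ∑-cong (seqs n) (λ q → trans (∑<-when (suc n) (does (q ≟ᵥ p)) (λ u → when (does (u ≟ t)) (h (q ∷ʳ u))))
                                        (cong (when (does (q ≟ᵥ p))) (∑<-pick (suc n) t (λ u → h (q ∷ʳ u)) t≤n))) ⟩
      ∑ (seqs n) (λ q → when (does (q ≟ᵥ p)) (h (q ∷ʳ t)))
        ≡⟨ ∑-seqs-pick n p p∈′ (λ q → h (q ∷ʳ t)) ⟩
      h (p ∷ʳ t) ∎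
      where open ≡-Reasoning

  open CommutativeMonoidSums +-0-isCommutativeMonoid
  open SequenceSums +-0-isCommutativeMonoid

  length-∑ : ∀ {B : Set} (xs : List B) → length xs ≡ ∑ xs (λ _ → 1)
  length-∑ []       = refl
  length-∑ (x ∷ xs) = cong suc (length-∑ xs)

  count-lag : ∀ n m t → ∑ (seqs n) (λ p → when (does (Vec.sum p + t ≟ m)) 1) ≡ lag (s n) m t
  count-lag n m zero = begin
    ∑ (seqs n) (λ p → when (does (Vec.sum p + 0 ≟ m)) 1)      ≡⟨ cong (λ k → ∑ (seqs n) (λ p → when (does (Vec.sum p + 0 ≟ k)) 1))
                                                                   (sym (+-identityʳ m)) ⟩
    ∑ (seqs n) (λ p → when (does (Vec.sum p + 0 ≟ m + 0)) 1)  ≡⟨ ∑-seqs-level n m 0 (λ _ → 1) ⟩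
    ∑ (𝒳 n m) (λ _ → 1)                                    ≡⟨ sym (length-∑ (𝒳 n m)) ⟩
    s n m                                                  ∎
    where open ≡-Reasoning
  count-lag n zero (suc t) = trans
    (∑-cong (seqs n) (λ p → cong (λ z → when (does (z ≟ 0)) 1) (+-suc (Vec.sum p) t))) (∑-ε (seqs n))
  count-lag n (suc m) (suc t) = trans
    (∑-cong (seqs n) (λ p → cong (λ z → when (does (z ≟ suc m)) 1) (+-suc (Vec.sum p) t))) (count-lag n m t)

  s-suc : ∀ n m → s (suc n) m ≡ window (s n) n m
  s-suc n m = begin
    s (suc n) m                                                          ≡⟨ length-∑ (𝒳 (suc n) m) ⟩
    ∑ (𝒳 (suc n) m) (λ _ → 1)                                           ≡⟨ ∑-𝒳-suc n m (λ _ _ → 1) ⟩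
    ∑ (seqs n) (λ p → ∑< (suc n) (λ t → when (does (Vec.sum p + t ≟ m)) 1)) ≡⟨ ∑-∑<-comm (seqs n) (suc n) (λ p t → when (does (Vec.sum p + t ≟ m)) 1) ⟩
    ∑< (suc n) (λ t → ∑ (seqs n) (λ p → when (does (Vec.sum p + t ≟ m)) 1)) ≡⟨ ∑<-cong (suc n) (λ t _ → count-lag n m t) ⟩
    window (s n) n m                                                     ∎
    where open ≡-Reasoning

  -- Mahonian numbers are ratio-decreasing (by induction, windows preserve it).
  s-ratio : ∀ n → RatioDecreasing (s n)
  s-ratio zero    zero    j _   = z≤n
  s-ratio zero    (suc i) j _   = z≤n
  s-ratio (suc n) i       j i≤j rewrite s-suc n i | s-suc n (suc j) | s-suc n (suc i) | s-suc n j =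
    window-ratio (s n) (s-ratio n) n i j i≤j

  C2-suc : ∀ n → suc n C 2 ≡ n + n C 2
  C2-suc n = trans (sym (nCk+nC[k+1]≡[n+1]C[k+1] n 1)) (cong (_+ n C 2) (nC1≡n n))

  s-positive : ∀ n j → j ≤ n C 2 → 0 < s n j
  s-positive zero    zero _ = s≤s z≤n
  s-positive (suc n) j j≤ rewrite s-suc n j with j ≤? n C 2
  ... | yes j≤′ = <-≤-trans (s-positive n j j≤′) (∑<-term (suc n) (lag (s n) j) 0 (s≤s z≤n))
  ... | no j≰ = <-≤-trans (subst (0 <_) (sym (lag-≡ (s n) (n C 2) t (sym top+t≡j))) (s-positive n (n C 2) ≤-refl))
                          (∑<-term (suc n) (lag (s n) j) t (s≤s t≤n))
    where
    t : ℕ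
    t = j ∸ n C 2
    top+t≡j : n C 2 + t ≡ j
    top+t≡j = m+[n∸m]≡n (<⇒≤ (≰⇒> j≰))
    t≤n : t ≤ n
    t≤n = ≤-trans (∸-monoˡ-≤ (n C 2) (subst (j ≤_) (C2-suc n) j≤)) (≤-reflexive (m+n∸n≡m n (n C 2)))

module Construction where

  open import Data.Bool using (Bool; true; false)
  open import Data.Empty using (⊥-elim)
  open import Data.Fin using (Fin; inject₁; fromℕ) renaming (zero to fzero; suc to fsuc)
  open import Data.List using (List; []; _∷_)
  open import Data.List.Membership.Propositional using (_∈_)
  open import Data.List.Membership.Propositional.Properties using (∈-length)
  open import Data.Nat as ℕ using (ℕ; zero; suc; _≟_; _<_; _≤_; _∸_; z≤n; s≤s)
  open import Data.Nat.Combinatorics using (_C_)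
  import Data.Nat.Properties as ℕ
  open import Data.Product using (Σ; _×_; _,_; proj₁; proj₂)
  open import Data.Rational using (ℚ; 0ℚ; 1ℚ; _+_; _*_) renaming (_≤_ to _≤ℚ_)
  import Data.Rational.Properties as ℚ
  open import Data.Sum using (_⊎_; inj₁; inj₂)
  open import Data.Vec using (Vec; _∷ʳ_; lookup; init; last; initLast) renaming ([] to []ᵥ; _∷_ to _∷ᵥ_)
  import Data.Vec as Vec
  open import Relation.Binary.PropositionalEquality
  open import Relation.Nullary using (¬_; yes; no; does)
  open import Relation.Nullary.Decidable using (dec-true; dec-false)
  open import Function using (_∘′_)
  open import Defs
  open FiniteSums
  open Windows
  open Fractions
  open InversionSequences

  -- Over ℚ, ∑ is definitionally the sum Σℚ of the statement.
  open CommutativeMonoidSums ℚ.+-0-isCommutativeMonoid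
  open SequenceSums ℚ.+-0-isCommutativeMonoid

  -- The chain on sequences of length n+1 lifts the chain on their prefixes of
  -- length n.  From x = p ∷ʳ t at level M it raises the last entry t with
  -- probability α n M t, and otherwise (probability β n M t = 1 - α n M t) keeps
  -- t and moves p by the chain of length n.  α is the normalised flow across
  -- the cut {last entry ≤ t} of Flow (s n) n, the window that computes the
  -- level sizes  s (n+1) m.
  module F n = Flow (s n) n

  α β : ℕ → ℕ → ℕ → ℚ
  α n M t = frac (F.H n t M) (F.D n t M)
  β n M t = frac (F.D n t M ∸ F.H n t M) (F.D n t M)

  extend : ∀ n → (Vec ℕ n → Vec ℕ n → ℚ) → ℕ → Vec ℕ n → ℕ → Vec ℕ n → ℕ → ℚ
  extend n ρₙ M p t q u = when (does (u ≟ t)) (β n M t * ρₙ p q)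
                        + when (does (u ≟ suc t)) (when (does (q ≟ᵥ p)) (α n M t))

  -- The transition matrix from level m to level m+1 (for every m at once).
  ρ : ∀ n → Vec ℕ n → Vec ℕ n → ℚ
  ρ zero    _ _ = 0ℚ
  ρ (suc n) x y = extend n (ρ n) (Vec.sum x) (init x) (last x) (init y) (last y)

  0≤when : ∀ b q → 0ℚ ≤ℚ q → 0ℚ ≤ℚ when b q
  0≤when true  q 0≤q = 0≤q
  0≤when false q _   = ℚ.≤-refl

  extend-nonneg : ∀ n ρₙ M p t q u → 0ℚ ≤ℚ ρₙ p q → 0ℚ ≤ℚ extend n ρₙ M p t q u
  extend-nonneg n ρₙ M p t q u 0≤ρₙ = 0≤+ stay raise
    (0≤when (does (u ≟ t)) _ (0≤* (β n M t) (ρₙ p q) (0≤frac (F.D n t M ∸ F.H n t M) (F.D n t M)) 0≤ρₙ))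
    (0≤when (does (u ≟ suc t)) _ (0≤when (does (q ≟ᵥ p)) _ (0≤frac (F.H n t M) (F.D n t M))))
    where
    stay raise : ℚ
    stay  = when (does (u ≟ t)) (β n M t * ρₙ p q)
    raise = when (does (u ≟ suc t)) (when (does (q ≟ᵥ p)) (α n M t))

  ρ-nonneg : ∀ n x y → 0ℚ ≤ℚ ρ n x y
  ρ-nonneg zero    x y = ℚ.≤-refl
  ρ-nonneg (suc n) x y =
    extend-nonneg n (ρ n) (Vec.sum x) (init x) (last x) (init y) (last y) (ρ-nonneg n (init x) (init y))

  index-view : ∀ {n} (i : Fin (suc n)) → (Σ (Fin n) λ i′ → i ≡ inject₁ i′) ⊎ (i ≡ fromℕ n)
  index-view {zero}  fzero    = inj₂ refl
  index-view {suc n} fzero    = inj₁ (fzero , refl)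
  index-view {suc n} (fsuc i) with index-view i
  ... | inj₁ (i′ , refl) = inj₁ (fsuc i′ , refl)
  ... | inj₂ refl        = inj₂ refl

  lookup-prefix : ∀ {n} (p : Vec ℕ n) t i → lookup (p ∷ʳ t) (inject₁ i) ≡ lookup p i
  lookup-prefix (x ∷ᵥ p) t fzero    = refl
  lookup-prefix (x ∷ᵥ p) t (fsuc i) = lookup-prefix p t i

  lookup-last : ∀ {n} (p : Vec ℕ n) t → lookup (p ∷ʳ t) (fromℕ n) ≡ t
  lookup-last []ᵥ       t = refl
  lookup-last (x ∷ᵥ p) t = lookup-last p t

  covers-prefix : ∀ {n} (q p : Vec ℕ n) t → Covers q p → Covers (q ∷ʳ t) (p ∷ʳ t)
  covers-prefix q p t (j , q≡p+1 , q≡p) =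
    inject₁ j , trans (lookup-prefix q t j) (trans q≡p+1 (cong suc (sym (lookup-prefix p t j)))) , elsewhere
    where
    elsewhere : ∀ i → i ≢ inject₁ j → lookup (q ∷ʳ t) i ≡ lookup (p ∷ʳ t) i
    elsewhere i i≢j with index-view i
    ... | inj₁ (i′ , refl) = trans (lookup-prefix q t i′) (trans (q≡p i′ (i≢j ∘′ cong inject₁)) (sym (lookup-prefix p t i′)))
    ... | inj₂ refl        = trans (lookup-last q t) (sym (lookup-last p t))

  covers-last : ∀ {n} (p : Vec ℕ n) t → Covers (p ∷ʳ suc t) (p ∷ʳ t)
  covers-last {n} p t = fromℕ n , trans (lookup-last p (suc t)) (cong suc (sym (lookup-last p t))) , elsewhere
    where
    elsewhere : ∀ i → i ≢ fromℕ n → lookup (p ∷ʳ suc t) i ≡ lookup (p ∷ʳ t) i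
    elsewhere i i≢last with index-view i
    ... | inj₁ (i′ , refl) = trans (lookup-prefix p (suc t) i′) (sym (lookup-prefix p t i′))
    ... | inj₂ refl        = ⊥-elim (i≢last refl)

  extend-support : ∀ n ρₙ M (p : Vec ℕ n) t q u → (¬ Covers q p → ρₙ p q ≡ 0ℚ) →
                   ¬ Covers (q ∷ʳ u) (p ∷ʳ t) → extend n ρₙ M p t q u ≡ 0ℚ
  extend-support n ρₙ M p t q u ρₙ-support ¬cover with u ≟ t
  ... | yes refl rewrite dec-true (u ≟ u) refl | dec-false (u ≟ suc u) (ℕ.1+n≢n ∘′ sym) | ρₙ-support (¬cover ∘′ covers-prefix q p u) =
    trans (cong (_+ 0ℚ) (ℚ.*-zeroʳ (β n M u))) (ℚ.+-identityʳ 0ℚ)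
  ... | no u≢t rewrite dec-false (u ≟ t) u≢t with u ≟ suc t
  ...   | no u≢t+1 rewrite dec-false (u ≟ suc t) u≢t+1 = ℚ.+-identityʳ 0ℚ
  ...   | yes refl rewrite dec-true (u ≟ u) refl with q ≟ᵥ p
  ...     | yes refl = ⊥-elim (¬cover (covers-last q t))
  ...     | no _     = ℚ.+-identityʳ 0ℚ

  ρ-support : ∀ n x y → ¬ Covers y x → ρ n x y ≡ 0ℚ
  ρ-support zero    x y _      = refl
  ρ-support (suc n) x y ¬cover =
    extend-support n (ρ n) (Vec.sum x) (init x) (last x) (init y) (last y) (ρ-support n (init x) (init y))
      (λ c → ¬cover (subst₂ Covers (sym (proj₂ (proj₂ (initLast y)))) (sym (proj₂ (proj₂ (initLast x)))) c))

  ∑-*ˡ : ∀ {B : Set} (xs : List B) c (f : B → ℚ) → ∑ xs (λ x → c * f x) ≡ c * ∑ xs f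
  ∑-*ˡ []       c f = sym (ℚ.*-zeroʳ c)
  ∑-*ˡ (x ∷ xs) c f = trans (cong (c * f x +_) (∑-*ˡ xs c f)) (sym (ℚ.*-distribˡ-+ c (f x) _))

  when-*ˡ : ∀ b c x → when b (c * x) ≡ c * when b x
  when-*ˡ true  c x = refl
  when-*ˡ false c x = sym (ℚ.*-zeroʳ c)

  row-stay : ∀ n (p : Vec ℕ n) t c → t < suc n →
    ∑ (seqs n) (λ q → ∑< (suc n) (λ u → when (does (Vec.sum q ℕ.+ u ≟ suc (Vec.sum p ℕ.+ t)))
                                           (when (does (u ≟ t)) (c * ρ n p q))))
      ≡ c * ∑ (𝒳 n (suc (Vec.sum p))) (ρ n p)
  row-stay n p t c t≤n = begin
    ∑ (seqs n) (λ q → ∑< (suc n) (λ u → when (does (Vec.sum q ℕ.+ u ≟ suc (Vec.sum p ℕ.+ t))) (when (does (u ≟ t)) (c * ρ n p q))))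
      ≡⟨ ∑-cong (seqs n) (λ q → trans (∑<-cong (suc n) (λ u _ → when-comm (does (Vec.sum q ℕ.+ u ≟ suc (Vec.sum p ℕ.+ t))) (does (u ≟ t)) (c * ρ n p q)))
                                      (∑<-pick (suc n) t (λ u → when (does (Vec.sum q ℕ.+ u ≟ suc (Vec.sum p ℕ.+ t))) (c * ρ n p q)) t≤n)) ⟩
    ∑ (seqs n) (λ q → when (does (Vec.sum q ℕ.+ t ≟ suc (Vec.sum p) ℕ.+ t)) (c * ρ n p q))
      ≡⟨ ∑-seqs-level n (suc (Vec.sum p)) t (λ q → c * ρ n p q) ⟩
    ∑ (𝒳 n (suc (Vec.sum p))) (λ q → c * ρ n p q)
      ≡⟨ ∑-*ˡ (𝒳 n (suc (Vec.sum p))) c (ρ n p) ⟩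
    c * ∑ (𝒳 n (suc (Vec.sum p))) (ρ n p) ∎
    where open ≡-Reasoning

  -- Raising t: the single target p ∷ʳ (t+1) receives α, which must vanish when
  -- t = n since then that target does not exist.
  row-raise : ∀ n (p : Vec ℕ n) t c → p ∈ seqs n → t < suc n → (t ≡ n → c ≡ 0ℚ) →
    ∑ (seqs n) (λ q → ∑< (suc n) (λ u → when (does (Vec.sum q ℕ.+ u ≟ suc (Vec.sum p ℕ.+ t)))
                                           (when (does (u ≟ suc t)) (when (does (q ≟ᵥ p)) c))))
      ≡ c
  row-raise n p t c p∈ t≤n top⇒c≡0 with ℕ.m<1+n⇒m<n∨m≡n t≤n
  ... | inj₂ refl = trans (∑-cong (seqs n) (λ q → trans (∑<-cong (suc n) (λ u _ → when-comm (level q u) (does (u ≟ suc n)) (same q)))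
                                                        (∑<-pick-none (suc n) (suc n) (λ u → when (level q u) (same q)) ℕ.≤-refl)))
                          (trans (∑-ε (seqs n)) (sym (top⇒c≡0 refl)))
    where
    level : Vec ℕ n → ℕ → Bool
    level q u = does (Vec.sum q ℕ.+ u ≟ suc (Vec.sum p ℕ.+ n))
    same : Vec ℕ n → ℚ
    same q = when (does (q ≟ᵥ p)) c
  ... | inj₁ t<n = begin
    ∑ (seqs n) (λ q → ∑< (suc n) (λ u → when (level q u) (when (does (u ≟ suc t)) (same q))))
      ≡⟨ ∑-cong (seqs n) (λ q → trans (∑<-cong (suc n) (λ u _ → when-comm (level q u) (does (u ≟ suc t)) (same q)))
                                      (∑<-pick (suc n) (suc t) (λ u → when (level q u) (same q)) (s≤s t<n))) ⟩
    ∑ (seqs n) (λ q → when (level q (suc t)) (same q))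
      ≡⟨ ∑-cong (seqs n) (λ q → when-comm (level q (suc t)) (does (q ≟ᵥ p)) c) ⟩
    ∑ (seqs n) (λ q → when (does (q ≟ᵥ p)) (when (level q (suc t)) c))
      ≡⟨ ∑-seqs-pick n p p∈ (λ q → when (level q (suc t)) c) ⟩
    when (level p (suc t)) c
      ≡⟨ cong (λ b → when b c) (dec-true (Vec.sum p ℕ.+ suc t ≟ suc (Vec.sum p ℕ.+ t)) (ℕ.+-suc (Vec.sum p) t)) ⟩
    c ∎
    where
    open ≡-Reasoning
    level : Vec ℕ n → ℕ → Bool
    level q u = does (Vec.sum q ℕ.+ u ≟ suc (Vec.sum p ℕ.+ t))
    same : Vec ℕ n → ℚ
    same q = when (does (q ≟ᵥ p)) c

  RowSums : ℕ → Set
  RowSums n = ∀ m x → x ∈ 𝒳 n m → 0 < s n (suc m) → ∑ (𝒳 n (suc m)) (ρ n x) ≡ 1ℚ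

  row-extend : ∀ n → RowSums n → ∀ (p : Vec ℕ n) t → p ∈ seqs n → t < suc n →
    0 < s (suc n) (suc (Vec.sum p ℕ.+ t)) →
    ∑ (seqs n) (λ q → ∑< (suc n) (λ u → when (does (Vec.sum q ℕ.+ u ≟ suc (Vec.sum p ℕ.+ t)))
                                           (extend n (ρ n) (Vec.sum p ℕ.+ t) p t q u)))
      ≡ 1ℚ
  row-extend n row-sumₙ p t p∈ t≤n 0<s′ = begin
    ∑ (seqs n) (λ q → ∑< (suc n) (λ u → when (level q u) (extend n (ρ n) M p t q u)))
      ≡⟨ ∑∑<-when-⊕ (seqs n) (suc n) level (λ q u → when (does (u ≟ t)) (β n M t * ρ n p q))
                                           (λ q u → when (does (u ≟ suc t)) (when (does (q ≟ᵥ p)) (α n M t))) ⟩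
    ∑ (seqs n) (λ q → ∑< (suc n) (λ u → when (level q u) (when (does (u ≟ t)) (β n M t * ρ n p q))))
      + ∑ (seqs n) (λ q → ∑< (suc n) (λ u → when (level q u) (when (does (u ≟ suc t)) (when (does (q ≟ᵥ p)) (α n M t)))))
      ≡⟨ cong₂ _+_ (row-stay n p t (β n M t) t≤n) (row-raise n p t (α n M t) p∈ t≤n α-top) ⟩
    β n M t * S + α n M t
      ≡⟨ stay-or-raise D H S 0<D (F.H≤D n t M (ℕ.≤-pred t≤n)) (prefix-row (s n (suc (Vec.sum p))) refl) ⟩
    1ℚ ∎
    where
    open ≡-Reasoning
    M D H : ℕ
    M = Vec.sum p ℕ.+ t
    D = F.D n t M
    H = F.H n t M
    S : ℚ
    S = ∑ (𝒳 n (suc (Vec.sum p))) (ρ n p)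
    level : Vec ℕ n → ℕ → Bool
    level q u = does (Vec.sum q ℕ.+ u ≟ suc M)
    α-top : t ≡ n → α n M t ≡ 0ℚ
    α-top refl = trans (cong (λ h → frac h D) (F.H-top n M)) (frac-0 D)
    0<D : 0 < D
    0<D = ℕ.*-mono-< (subst (0 <_) (s-suc n (suc M)) 0<s′)
                     (subst (0 <_) (sym (lag-≡ (s n) (Vec.sum p) t refl)) (∈-length (∈-𝒳⁺ p∈)))
    -- either the prefix row is a probability row, or p has no successor at all,
    -- and then nothing stays (all mass is raised)
    prefix-row : ∀ k → s n (suc (Vec.sum p)) ≡ k → S ≡ 1ℚ ⊎ (S ≡ 0ℚ × D ∸ H ≡ 0)
    prefix-row (suc k) s≡ = inj₁ (row-sumₙ (Vec.sum p) p (∈-𝒳⁺ p∈) (subst (0 <_) (sym s≡) (s≤s z≤n)))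
    prefix-row zero    s≡ = inj₂ (∑-empty (𝒳 n (suc (Vec.sum p))) (ρ n p) s≡ , ℕ.m+n≡0⇒m≡0 (D ∸ H) (begin
      (D ∸ H) ℕ.+ F.H⁻ n t M              ≡⟨ F.balance n (s-ratio n) t M (ℕ.≤-pred t≤n) ⟩
      F.B n M ℕ.* lag (s n) (suc M) t     ≡⟨ cong (F.B n M ℕ.*_) (trans (lag-≡ (s n) (suc (Vec.sum p)) t refl) s≡) ⟩
      F.B n M ℕ.* 0                       ≡⟨ ℕ.*-zeroʳ (F.B n M) ⟩
      0                                   ∎))

  row-sum : ∀ n → RowSums n
  row-sum zero    m x x∈ ()
  row-sum (suc n) m x x∈ 0<s′ with ∈-𝒳-suc⁻ x∈ | proj₂ (∈-𝒳⁻ x∈)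
  ... | p∈ , t≤n , refl | sum-x≡ = begin
    ∑ (𝒳 (suc n) (suc M)) (ρ (suc n) x)
      ≡⟨ ∑-𝒳-suc n (suc M) (extend n (ρ n) (Vec.sum x) (init x) (last x)) ⟩
    ∑ (seqs n) (λ q → ∑< (suc n) (λ u → when (does (Vec.sum q ℕ.+ u ≟ suc M)) (extend n (ρ n) (Vec.sum x) (init x) (last x) q u)))
      ≡⟨ cong (λ M′ → ∑ (seqs n) (λ q → ∑< (suc n) (λ u → when (does (Vec.sum q ℕ.+ u ≟ suc M)) (extend n (ρ n) M′ (init x) (last x) q u)))) sum-x≡ ⟩
    ∑ (seqs n) (λ q → ∑< (suc n) (λ u → when (does (Vec.sum q ℕ.+ u ≟ suc M)) (extend n (ρ n) M (init x) (last x) q u)))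
      ≡⟨ row-extend n (row-sum n) (init x) (last x) p∈ t≤n 0<s′ ⟩
    1ℚ ∎
    where
    open ≡-Reasoning
    M : ℕ
    M = Vec.sum (init x) ℕ.+ last x

  ColumnSums : ℕ → Set
  ColumnSums n = ∀ m y → y ∈ 𝒳 n (suc m) → ∑ (𝒳 n m) (λ x → ρ n x y) ≡ frac (s n m) (s n (suc m))

  column-stay : ∀ n (q : Vec ℕ n) u m (c : ℕ → ℚ) → u < suc n →
    ∑ (seqs n) (λ p → ∑< (suc n) (λ t → when (does (Vec.sum p ℕ.+ t ≟ m)) (when (does (u ≟ t)) (c t * ρ n p q))))
      ≡ c u * ∑ (seqs n) (λ p → when (does (Vec.sum p ℕ.+ u ≟ m)) (ρ n p q))
  column-stay n q u m c u≤n = trans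
    (∑-cong (seqs n) (λ p → begin
      ∑< (suc n) (λ t → when (level p t) (when (does (u ≟ t)) (c t * ρ n p q)))
        ≡⟨ ∑<-cong (suc n) (λ t _ → when-comm (level p t) (does (u ≟ t)) (c t * ρ n p q)) ⟩
      ∑< (suc n) (λ t → when (does (u ≟ t)) (when (level p t) (c t * ρ n p q)))
        ≡⟨ ∑<-pick-sym (suc n) u (λ t → when (level p t) (c t * ρ n p q)) u≤n ⟩
      when (level p u) (c u * ρ n p q)
        ≡⟨ when-*ˡ (level p u) (c u) (ρ n p q) ⟩
      c u * when (level p u) (ρ n p q) ∎))
    (∑-*ˡ (seqs n) (c u) (λ p → when (level p u) (ρ n p q)))
    where
    open ≡-Reasoning
    level : Vec ℕ n → ℕ → Bool
    level p t = does (Vec.sum p ℕ.+ t ≟ m)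

  column-prefix : ∀ n → ColumnSums n → ∀ (q : Vec ℕ n) u m → q ∈ seqs n → Vec.sum q ℕ.+ u ≡ suc m →
    ∑ (seqs n) (λ p → when (does (Vec.sum p ℕ.+ u ≟ m)) (ρ n p q)) ≡ frac (lag (s n) m u) (lag (s n) (suc m) u)
  column-prefix n column-sumₙ q u m q∈ level-q with Vec.sum q in sum-q≡
  ... | zero = begin
    ∑ (seqs n) (λ p → when (does (Vec.sum p ℕ.+ u ≟ m)) (ρ n p q))
      ≡⟨ ∑-cong (seqs n) (λ p → cong (λ b → when b (ρ n p q)) (dec-false (Vec.sum p ℕ.+ u ≟ m) (too-high p))) ⟩
    ∑ (seqs n) (λ p → 0ℚ)                                       ≡⟨ ∑-ε (seqs n) ⟩
    0ℚ                                                          ≡⟨ sym (frac-0 (lag (s n) (suc m) u)) ⟩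
    frac 0 (lag (s n) (suc m) u)                                ≡⟨ cong (λ z → frac z (lag (s n) (suc m) u)) (sym (lag-beyond (s n) m u u>m)) ⟩
    frac (lag (s n) m u) (lag (s n) (suc m) u)                  ∎
    where
    open ≡-Reasoning
    u>m : m < u
    u>m = ℕ.≤-reflexive (sym level-q)
    too-high : ∀ p → Vec.sum p ℕ.+ u ≢ m
    too-high p eq = ℕ.<-irrefl refl (ℕ.<-≤-trans u>m (subst (u ≤_) eq (ℕ.m≤n+m u (Vec.sum p))))
  ... | suc j with ℕ.suc-injective level-q
  ...   | refl = begin
    ∑ (seqs n) (λ p → when (does (Vec.sum p ℕ.+ u ≟ j ℕ.+ u)) (ρ n p q))  ≡⟨ ∑-seqs-level n j u (λ p → ρ n p q) ⟩
    ∑ (𝒳 n j) (λ p → ρ n p q)                                            ≡⟨ column-sumₙ j q (subst (λ k → q ∈ 𝒳 n k) sum-q≡ (∈-𝒳⁺ q∈)) ⟩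
    frac (s n j) (s n (suc j))                                           ≡⟨ cong₂ frac (sym (lag-≡ (s n) j u refl)) (sym (lag-≡ (s n) (suc j) u refl)) ⟩
    frac (lag (s n) (j ℕ.+ u) u) (lag (s n) (suc j ℕ.+ u) u)             ∎
    where open ≡-Reasoning

  previous : (ℕ → ℚ) → ℕ → ℚ
  previous c zero    = 0ℚ
  previous c (suc u) = c u

  -- Sources that raise their last entry: only q ∷ʳ (u-1) can do so.
  column-raise : ∀ n (q : Vec ℕ n) u m (c : ℕ → ℚ) → q ∈ seqs n → u < suc n → Vec.sum q ℕ.+ u ≡ suc m →
    ∑ (seqs n) (λ p → ∑< (suc n) (λ t → when (does (Vec.sum p ℕ.+ t ≟ m))
                                           (when (does (u ≟ suc t)) (when (does (q ≟ᵥ p)) (c t)))))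
      ≡ previous c u
  column-raise n q zero m c q∈ _ _ = trans (∑-cong (seqs n) (λ p →
    trans (∑<-cong (suc n) (λ t _ → when-ε (does (Vec.sum p ℕ.+ t ≟ m)))) (∑<-ε (suc n)))) (∑-ε (seqs n))
  column-raise n q (suc u) m c q∈ (s≤s u<n) level-q = begin
    ∑ (seqs n) (λ p → ∑< (suc n) (λ t → when (level p t) (when (does (u ≟ t)) (same p t))))
      ≡⟨ ∑-cong (seqs n) (λ p → trans (∑<-cong (suc n) (λ t _ → when-comm (level p t) (does (u ≟ t)) (same p t)))
                                      (∑<-pick-sym (suc n) u (λ t → when (level p t) (same p t)) (ℕ.m≤n⇒m≤1+n u<n))) ⟩
    ∑ (seqs n) (λ p → when (level p u) (when (does (q ≟ᵥ p)) (c u)))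
      ≡⟨ ∑-cong (seqs n) (λ p → trans (when-comm (level p u) (does (q ≟ᵥ p)) (c u))
                                      (cong (λ b → when b (when (level p u) (c u))) (≟ᵥ-sym q p))) ⟩
    ∑ (seqs n) (λ p → when (does (p ≟ᵥ q)) (when (level p u) (c u)))
      ≡⟨ ∑-seqs-pick n q q∈ (λ p → when (level p u) (c u)) ⟩
    when (level q u) (c u)
      ≡⟨ cong (λ b → when b (c u)) (dec-true (Vec.sum q ℕ.+ u ≟ m) (ℕ.suc-injective (trans (sym (ℕ.+-suc _ u)) level-q))) ⟩
    c u ∎
    where
    open ≡-Reasoning
    level : Vec ℕ n → ℕ → Bool
    level p t = does (Vec.sum p ℕ.+ t ≟ m)
    same : Vec ℕ n → ℕ → ℚ
    same p t = when (does (q ≟ᵥ p)) (c t)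

  previous-α : ∀ n m u → previous (α n m) u ≡ frac (F.H⁻ n u m) (F.B n (suc m) ℕ.* lag (s n) (suc m) u)
  previous-α n m zero    = sym (frac-0 (F.B n (suc m) ℕ.* lag (s n) (suc m) 0))
  previous-α n m (suc u) = refl

  column-extend : ∀ n → ColumnSums n → ∀ (q : Vec ℕ n) u m → q ∈ seqs n → u < suc n → Vec.sum q ℕ.+ u ≡ suc m →
    ∑ (seqs n) (λ p → ∑< (suc n) (λ t → when (does (Vec.sum p ℕ.+ t ≟ m)) (extend n (ρ n) m p t q u)))
      ≡ frac (s (suc n) m) (s (suc n) (suc m))
  column-extend n column-sumₙ q u m q∈ u≤n level-q = begin
    ∑ (seqs n) (λ p → ∑< (suc n) (λ t → when (level p t) (extend n (ρ n) m p t q u)))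
      ≡⟨ ∑∑<-when-⊕ (seqs n) (suc n) level (λ p t → when (does (u ≟ t)) (β n m t * ρ n p q))
                                           (λ p t → when (does (u ≟ suc t)) (when (does (q ≟ᵥ p)) (α n m t))) ⟩
    ∑ (seqs n) (λ p → ∑< (suc n) (λ t → when (level p t) (when (does (u ≟ t)) (β n m t * ρ n p q))))
      + ∑ (seqs n) (λ p → ∑< (suc n) (λ t → when (level p t) (when (does (u ≟ suc t)) (when (does (q ≟ᵥ p)) (α n m t)))))
      ≡⟨ cong₂ _+_ (trans (column-stay n q u m (β n m) u≤n) (cong (β n m u *_) (column-prefix n column-sumₙ q u m q∈ level-q)))
                   (trans (column-raise n q u m (α n m) q∈ u≤n level-q) (previous-α n m u)) ⟩
    frac (D ∸ H) (F.B n (suc m) ℕ.* A) * frac A A′ + frac (F.H⁻ n u m) (F.B n (suc m) ℕ.* A′)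
      ≡⟨ frac-recombine (F.B n m) (F.B n (suc m)) A A′ (D ∸ H) (F.H⁻ n u m) 0<A′
                        (F.balance n (s-ratio n) u m (ℕ.≤-pred u≤n)) nothing-stays ⟩
    frac (F.B n m) (F.B n (suc m))
      ≡⟨ cong₂ frac (sym (s-suc n m)) (sym (s-suc n (suc m))) ⟩
    frac (s (suc n) m) (s (suc n) (suc m)) ∎
    where
    open ≡-Reasoning
    level : Vec ℕ n → ℕ → Bool
    level p t = does (Vec.sum p ℕ.+ t ≟ m)
    A A′ D H : ℕ
    A  = lag (s n) m u
    A′ = lag (s n) (suc m) u
    D  = F.D n u m
    H  = F.H n u m
    0<A′ : 0 < A′
    0<A′ = subst (0 <_) (sym (lag-≡ (s n) (Vec.sum q) u (sym level-q))) (∈-length (∈-𝒳⁺ q∈))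
    nothing-stays : A ≡ 0 → D ∸ H ≡ 0
    nothing-stays A≡0 rewrite A≡0 | ℕ.*-zeroʳ (F.B n (suc m)) = ℕ.0∸n≡0 H

  column-sum : ∀ n → ColumnSums n
  column-sum zero    m y ()
  column-sum (suc n) m y y∈ with ∈-𝒳-suc⁻ y∈
  ... | q∈ , u≤n , level-q = begin
    ∑ (𝒳 (suc n) m) (λ x → ρ (suc n) x y)
      ≡⟨ ∑-cong-∈ (𝒳 (suc n) m) (λ x x∈ → cong (λ M → extend n (ρ n) M (init x) (last x) (init y) (last y)) (proj₂ (∈-𝒳⁻ x∈))) ⟩
    ∑ (𝒳 (suc n) m) (λ x → extend n (ρ n) m (init x) (last x) (init y) (last y))
      ≡⟨ ∑-𝒳-suc n m (λ p t → extend n (ρ n) m p t (init y) (last y)) ⟩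
    ∑ (seqs n) (λ p → ∑< (suc n) (λ t → when (does (Vec.sum p ℕ.+ t ≟ m)) (extend n (ρ n) m p t (init y) (last y))))
      ≡⟨ column-extend n (column-sum n) (init y) (last y) m q∈ u≤n level-q ⟩
    frac (s (suc n) m) (s (suc n) (suc m)) ∎
    where open ≡-Reasoning

  -- Under the hypotheses of the theorem, level m+1 lies within 0 … C(n,2)
  -- (for n = k+2, C(n,2) = (k+1) + C(k+1,2) is a successor, so ∸ 1 undoes it).
  next-level-in-range : ∀ n m → 2 ≤ n → m ≤ (n C 2) ∸ 1 → suc m ≤ n C 2
  next-level-in-range (suc zero)    m (s≤s ()) _
  next-level-in-range (suc (suc k)) m _ m≤ with suc (suc k) C 2 | C2-suc (suc k)
  ... | _ | refl = s≤s m≤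

open import Defs
open import Data.Nat using (ℕ; suc; _≤_; _∸_)
open import Data.Nat.Combinatorics using (_C_)
open import Data.Vec using (Vec)
open import Data.Product using (Σ; _×_; _,_)
open import Data.List.Membership.Propositional using (_∈_)
open import Data.Rational using (ℚ; 0ℚ; _*_)
import Data.Rational as Q
open import Relation.Binary.PropositionalEquality using (_≡_; trans; cong)
open import Relation.Nullary using (¬_)
open import Data.Nat.Properties using (<⇒≤)
open Fractions using (recip-frac)
open InversionSequences using (s-positive)
open Construction using (ρ; ρ-nonneg; row-sum; column-sum; ρ-support; next-level-in-range)

-- The matrices ρ n work for every level; rows need level m+1 to be nonempty
-- and the normalisation of the columns needs level m to be nonempty.
theorem2p3 : (n m : ℕ) → 2 ≤ n → m ≤ (n C 2) ∸ 1 →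
    Σ (Vec ℕ n → Vec ℕ n → ℚ) λ ρ →
      (∀ x y → x ∈ 𝒳 n m → y ∈ 𝒳 n (suc m) → 0ℚ Q.≤ ρ x y)
      × (∀ x → x ∈ 𝒳 n m → Σℚ (𝒳 n (suc m)) (λ y → ρ x y) ≡ Q.1ℚ)
      × (∀ y → y ∈ 𝒳 n (suc m) → recip (s n m) * Σℚ (𝒳 n m) (λ x → ρ x y) ≡ recip (s n (suc m)))
      × (∀ x y → x ∈ 𝒳 n m → y ∈ 𝒳 n (suc m) → ¬ Covers y x → ρ x y ≡ 0ℚ)
theorem2p3 n m 2≤n m≤ =
  ρ n ,
  (λ x y _ _ → ρ-nonneg n x y) ,
  (λ x x∈ → row-sum n m x x∈ (s-positive n (suc m) m+1≤top)) ,
  (λ y y∈ → trans (cong (recip (s n m) *_) (column-sum n m y y∈))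
                  (recip-frac (s n m) (s n (suc m)) (s-positive n m (<⇒≤ m+1≤top)))) ,
  (λ x y _ _ → ρ-support n x y)
  where
  m+1≤top : suc m ≤ n C 2
  m+1≤top = next-level-in-range n m 2≤n m≤
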